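{- Let $m\ge1$ and $n\ge2$. Every $m$-Dyck path $P$ of size $n$, viewed as an element of $\mathbb K[\mathrm{Dyck}^m]$, is a linear combination of elements of the form $R_1*_iR_2$ with $0\le i\le m$ and $R_1,R_2$ $m$-Dyck paths of sizes strictly smaller than $n$.
   Context: An $m$-Dyck path of size $n\ge1$: lattice path from $(0,0)$ to $(2nm,0)$ with $n$ up steps $(m,m)$ and $nm$ down steps $(1,-1)$, never below the $x$-axis. $\mathbb K[\mathrm{Dyck}^m]$ is the vector space with basis all such paths of positive size. Up steps are ranked $1,\dots,n$; a down step is at level $k$ if the last preceding up step has rank $k$; $L(P)$ = number of level-$n$ down steps, listed $d^P_1,\dots,d^P_{L(P)}$. $P\times_jQ$ ($0\le j\le L(P)$): delete the last $j$ down steps of $P$, append a translate of $Q$, append $j$ down steps. Prime: not $A\times_0B$ with $A,B$ of smaller positive size; every path is uniquely $Q_1\times_0\cdots\times_0Q_r$ with $Q_j$ prime. Coloring $\alpha_P(d)$: rank of the first up step of $P$ met by the leftward horizontal half-line from the midpoint of $d$. $\Lambda^i_r(P)$: weak compositions $(\lambda_0,\dots,\lambda_r)$ of $L(P)$ such that in the word $\alpha_P(d^P_{L(P)-\lambda_r+1})\cdots\alpha_P(d^P_{L(P)})$ every integer appears at most $i$ times and some integer exactly $i$ times. For $Q=Q_1\times_0\cdots\times_0Q_r$ ($Q_j$ prime), $P*_{\underline\lambda}Q:=((\cdots(P\times_{\lambda_1+\dots+\lambda_r}Q_1)\cdots)\times_{\lambda_r}Q_r)$ and $P*_iQ:=\sum_{\underline\lambda\in\Lambda^i_r(P)}P*_{\underline\lambda}Q$,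 extended bilinearly. -}

module Defs where

open import Level using (Level; _⊔_) renaming (suc to lsuc)
import Data.Nat as ℕ
open import Data.Nat using (ℕ; zero; suc; _∸_; _≤_; _<_; _<ᵇ_; _≤ᵇ_; _≡ᵇ_)
open import Data.Bool using (Bool; true; false; _∧_; if_then_else_)
open import Data.List using (List; []; _∷_; _++_; length; take; drop; replicate; concat; concatMap; map; upTo; reverse; foldr)
open import Data.Nat.ListAction using (sum)
open import Data.List.Relation.Unary.All using (All)
open import Data.Product using (Σ; ∃; _×_; _,_)
open import Data.Empty using (⊥)
open import Relation.Nullary using (¬_)
open import Relation.Binary.PropositionalEquality using (_≡_)
open import Algebra.Bundles using (CommutativeRing)

record Field (c ℓ : Level) : Set (lsuc (c ⊔ ℓ)) where
  field
    commutativeRing : CommutativeRing c ℓ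
  open CommutativeRing commutativeRing public
  field
    nontrivial : ¬ (1# ≈ 0#)
    inverse    : ∀ x → ¬ (x ≈ 0#) → Σ Carrier (λ y → (x * y) ≈ 1#)

-- Lattice paths.  U = up step (m,m), D = down step (1,-1).

data Step : Set where
  U D : Step

Path : Set
Path = List Step

OkFrom : ℕ → ℕ → Path → Set
OkFrom m h []          = h ≡ 0
OkFrom m h (U ∷ w)     = OkFrom m (h ℕ.+ m) w
OkFrom m zero (D ∷ w)  = ⊥
OkFrom m (suc h) (D ∷ w) = OkFrom m h w

IsDyck : ℕ → Path → Set
IsDyck m w = OkFrom m 0 w

size : Path → ℕ
size []      = 0
size (U ∷ w) = suc (size w)
size (D ∷ w) = size w

-- m-Dyck path of positive size, i.e. a basis element of K[Dyck^m].
IsDyck⁺ : ℕ → Path → Set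
IsDyck⁺ m w = IsDyck m w × 1 ≤ size w

_×[_]_ : Path → ℕ → Path → Path
P ×[ j ] Q = take (length P ∸ j) P ++ (Q ++ replicate j D)

-- Prime: not A ×_0 B (= A ++ B) with A, B of (smaller) positive size.
IsPrime : ℕ → Path → Set
IsPrime m Q = IsDyck⁺ m Q ×
  ¬ (Σ Path λ A → Σ Path λ B → IsDyck⁺ m A × IsDyck⁺ m B × Q ≡ A ++ B)

IsPrimeDecomp : ℕ → Path → List Path → Set
IsPrimeDecomp m Q Qs = 1 ≤ length Qs × All (IsPrime m) Qs × concat Qs ≡ Q

isDᵇ : Step → Bool
isDᵇ U = false
isDᵇ D = true

trailingDs : Path → ℕ
trailingDs []      = 0
trailingDs (s ∷ w) = if isDᵇ s then suc (trailingDs w) else 0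

-- L(P): the down steps at level n (= size P) are exactly the final run of
-- down steps (those after the last up step, which has rank n).
L : Path → ℕ
L P = trailingDs (reverse P)

-- α_P(d) for a down step d starting at height h: the rank of the most recent
-- preceding up step (from height a to a+m) crossed by the horizontal line at
-- height h - 1/2, i.e. with a < h - 1/2 < a + m, i.e. a < h ≤ a + m.
-- 'ups' lists the preceding up steps (start height, rank), most recent first.
findColor : ℕ → ℕ → List (ℕ × ℕ) → ℕ
findColor m h []              = 0
findColor m h ((a , r) ∷ ups) = if (a <ᵇ h) ∧ (h ≤ᵇ a ℕ.+ m) then r else findColor m h ups

colorsFrom : ℕ → ℕ → ℕ → List (ℕ × ℕ) → Path → List ℕ
colorsFrom m h k ups []      = []
colorsFrom m h k ups (U ∷ w) = colorsFrom m (h ℕ.+ m) (suc k) ((h , suc k) ∷ ups) w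
colorsFrom m h k ups (D ∷ w) = findColor m h ups ∷ colorsFrom m (h ∸ 1) k ups w

downColors : ℕ → Path → List ℕ
downColors m P = colorsFrom m 0 0 [] P

lastColors : ℕ → Path → ℕ → List ℕ
lastColors m P j = let cs = downColors m P in drop (length cs ∸ j) cs

count : ℕ → List ℕ → ℕ
count k []      = 0
count k (x ∷ w) = if k ≡ᵇ x then suc (count k w) else count k w

-- maximal multiplicity of a letter (0 for the empty word).  "every integer
-- appears at most i times and some integer exactly i times" ⇔ maxMult w = i.
maxMult : List ℕ → ℕ
maxMult w = foldr (λ k acc → count k w ℕ.⊔ acc) 0 w

lastOr0 : List ℕ → ℕ
lastOr0 []          = 0
lastOr0 (x ∷ [])    = x
lastOr0 (_ ∷ y ∷ w) = lastOr0 (y ∷ w)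

comps : ℕ → ℕ → List (List ℕ)
comps zero zero    = [] ∷ []
comps zero (suc t) = []
comps (suc k) t    = concatMap (λ j → map (j ∷_) (comps k (t ∸ j))) (upTo (suc t))

-- (λ₀,…,λ_r) ∈ Λ^i_r(P)  (given that it is a weak composition of L(P))
inΛᵇ : ℕ → ℕ → Path → List ℕ → Bool
inΛᵇ m i P λs = maxMult (lastColors m P (lastOr0 λs)) ≡ᵇ i

-- P *_λ Q = ((⋯(P ×_{λ₁+⋯+λ_r} Q₁)⋯) ×_{λ_r} Q_r), given (λ₁,…,λ_r), (Q₁,…,Q_r)
starGo : Path → List ℕ → List Path → Path
starGo acc (l ∷ ls) (Q ∷ Qs) = starGo (acc ×[ sum (l ∷ ls) ] Q) ls Qs
starGo acc _        _        = acc

starλ : Path → List ℕ → List Path → Path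
starλ P []        Qs = P
starλ P (_ ∷ λs) Qs = starGo P λs Qs

stepEqᵇ : Step → Step → Bool
stepEqᵇ U U = true
stepEqᵇ D D = true
stepEqᵇ _ _ = false

pathEqᵇ : Path → Path → Bool
pathEqᵇ []      []      = true
pathEqᵇ (s ∷ v) (t ∷ w) = stepEqᵇ s t ∧ pathEqᵇ v w
pathEqᵇ _       _       = false

-- The free vector space K[Dyck^m]: elements are described by their
-- coefficient functions Path → K (finite support).

module FreeVec {c ℓ} (F : Field c ℓ) where
  open Field F

  bool→K : Bool → Carrier
  bool→K true  = 1#
  bool→K false = 0#

  sumK : List Carrier → Carrier
  sumK = foldr _+_ 0#

  basisCoeff : Path → Path → Carrier
  basisCoeff P S = bool→K (pathEqᵇ P S)

  -- coefficient of S in P *_i Q, where Qs is the prime decomposition of Q: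
  -- P *_i Q = Σ_{λ ∈ Λ^i_r(P)} P *_λ Q.
  starCoeff : ℕ → ℕ → Path → List Path → Path → Carrier
  starCoeff m i P Qs S =
    sumK (map (λ λs → bool→K (inΛᵇ m i P λs ∧ pathEqᵇ (starλ P λs Qs) S))
              (comps (suc (length Qs)) (L P)))

  record Term (m n : ℕ) : Set (c ⊔ ℓ) where
    field
      coef   : Carrier
      i      : ℕ
      i≤m    : i ≤ m
      R₁ R₂  : Path
      R₁-ok  : IsDyck⁺ m R₁
      R₂-ok  : IsDyck⁺ m R₂
      R₁<n   : size R₁ < n
      R₂<n   : size R₂ < n
      Qs     : List Path
      Qs-ok  : IsPrimeDecomp m R₂ Qs

  termCoeff : ∀ {m n} → Term m n → Path → Carrier
  termCoeff {m} t S = coef * starCoeff m i R₁ Qs S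
    where open Term t

  IsLinCombOfStars : ℕ → ℕ → Path → Set (c ⊔ ℓ)
  IsLinCombOfStars m n P =
    Σ (List (Term m n)) λ ts → ∀ S → basisCoeff P S ≈ sumK (map (λ t → termCoeff t S) ts)

-- After its first up step, P descends from height m to some level j ≤ m and
-- then runs through a prime path Q lifted to height j before its final descent.
-- So P = R ×_j Q, where the last j down steps of R all have colour 1 (each lies
-- below the first up step, and R never returns below level j in between).  Hence
-- R *_j Q contains P with coefficient 1, and otherwise only paths R ×_k Q with
-- k > j, which have the size and length of P but a longer final descent.
-- Induction on length P ∸ L P expresses those, and then P, through products.
module Submission where

open import Defs
import Level
open import Level using (Level)
open import Data.Nat using (ℕ; zero; suc; _∸_; _≤_; _<_; z≤n; s≤s; _≡ᵇ_)
open import Function using (_∘_; _on_)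
open import Data.Nat.Induction using (<-wellFounded)
open import Data.Bool using (true; false; _∧_; if_then_else_)
open import Data.Bool.Properties using (T-≡)
open import Data.Unit using (tt)
open import Data.Empty using (⊥-elim)
open import Data.Sum using (inj₁; inj₂)
open import Data.Product as Product using (Σ; ∃; _,_; proj₁; proj₂)
open import Data.List using (List; []; _∷_; _++_; _∷ʳ_; [_]; length; take; drop; replicate; concat; concatMap; map; upTo; applyUpTo; downFrom; reverse; foldr)
open import Data.List.Properties using (++-assoc; ++-identityʳ; length-++; length-replicate; length-reverse; length-drop; reverse-++; reverse-involutive; unfold-reverse; ∷-injectiveʳ; map-∘; map-cong; concatMap-++; concat-map-[_]; upTo-∷ʳ; map-applyUpTo; map-upTo)
open import Data.List.Relation.Unary.All using (All; []; _∷_)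
open import Data.List.Relation.Unary.All.Properties using (all-upTo)
open import Function.Bundles using (Equivalence)
open import Relation.Nullary using (yes; no)
open import Relation.Binary.PropositionalEquality using (_≡_; _≢_; refl; sym; trans; cong; cong₂; subst; subst₂; module ≡-Reasoning)
open import Induction.WellFounded using (WfRec; module All)
import Relation.Binary.Construct.On as On

module Paths where

  open import Data.Nat using (_+_; _⊔_; _<ᵇ_; _≤ᵇ_; _≤?_)
  open import Data.Nat.Properties
  open import Algebra.Properties.CommutativeSemigroup +-commutativeSemigroup using (xy∙z≈xz∙y; x∙yz≈xz∙y)

  Dn : ℕ → Path
  Dn k = replicate k D

  Dn-++ : ∀ a b → Dn a ++ Dn b ≡ Dn (a + b)
  Dn-++ zero    b = refl
  Dn-++ (suc a) b = cong (D ∷_) (Dn-++ a b)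

  reverse-Dn : ∀ k → reverse (Dn k) ≡ Dn k
  reverse-Dn zero    = refl
  reverse-Dn (suc k) = begin
    reverse (D ∷ Dn k)   ≡⟨ unfold-reverse D (Dn k) ⟩
    reverse (Dn k) ∷ʳ D  ≡⟨ cong (_∷ʳ D) (reverse-Dn k) ⟩
    Dn k ++ Dn 1         ≡⟨ Dn-++ k 1 ⟩
    Dn (k + 1)           ≡⟨ cong Dn (+-comm k 1) ⟩
    Dn (suc k)           ∎
    where open ≡-Reasoning

  take-length-++ : ∀ {A : Set} (xs ys : List A) → take (length xs) (xs ++ ys) ≡ xs
  take-length-++ []       ys = refl
  take-length-++ (x ∷ xs) ys = cong (x ∷_) (take-length-++ xs ys)

  drop-length-++ : ∀ {A : Set} (xs ys : List A) → drop (length xs) (xs ++ ys) ≡ ys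
  drop-length-++ []       ys = refl
  drop-length-++ (x ∷ xs) ys = drop-length-++ xs ys

  length-++-replicate-∸ : ∀ {A : Set} (xs : List A) k x → length (xs ++ replicate k x) ∸ k ≡ length xs
  length-++-replicate-∸ xs k x = begin
    length (xs ++ replicate k x) ∸ k        ≡⟨ cong (_∸ k) (length-++ xs) ⟩
    length xs + length (replicate k x) ∸ k  ≡⟨ cong (λ l → length xs + l ∸ k) (length-replicate k) ⟩
    length xs + k ∸ k                       ≡⟨ m+n∸n≡m (length xs) k ⟩
    length xs                               ∎
    where open ≡-Reasoning

  size-++ : ∀ A B → size (A ++ B) ≡ size A + size B
  size-++ []      B = refl
  size-++ (U ∷ A) B = cong suc (size-++ A B)
  size-++ (D ∷ A) B = size-++ A B

  size-insert : ∀ A Q B → size (A ++ Q ++ B) ≡ size (A ++ B) + size Q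
  size-insert A Q B = begin
    size (A ++ Q ++ B)           ≡⟨ size-++ A (Q ++ B) ⟩
    size A + size (Q ++ B)       ≡⟨ cong (size A +_) (size-++ Q B) ⟩
    size A + (size Q + size B)   ≡⟨ x∙yz≈xz∙y (size A) (size Q) (size B) ⟩
    (size A + size B) + size Q   ≡⟨ cong (_+ size Q) (size-++ A B) ⟨
    size (A ++ B) + size Q       ∎
    where open ≡-Reasoning

  length-insert : ∀ (A Q B : Path) → length (A ++ Q ++ B) ≡ length (A ++ B) + length Q
  length-insert A Q B = begin
    length (A ++ Q ++ B)             ≡⟨ length-++ A ⟩
    length A + length (Q ++ B)       ≡⟨ cong (length A +_) (length-++ Q) ⟩
    length A + (length Q + length B) ≡⟨ x∙yz≈xz∙y (length A) (length Q) (length B) ⟩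
    (length A + length B) + length Q ≡⟨ cong (_+ length Q) (length-++ A) ⟨
    length (A ++ B) + length Q       ∎
    where open ≡-Reasoning

  -- The final descent L

  trailingDs-Dn-++ : ∀ k V → trailingDs (Dn k ++ V) ≡ k + trailingDs V
  trailingDs-Dn-++ zero    V = refl
  trailingDs-Dn-++ (suc k) V = cong suc (trailingDs-Dn-++ k V)

  trailingDs-++-U∷ : ∀ V W W′ → trailingDs (V ++ U ∷ W) ≡ trailingDs (V ++ U ∷ W′)
  trailingDs-++-U∷ []      W W′ = refl
  trailingDs-++-U∷ (U ∷ V) W W′ = refl
  trailingDs-++-U∷ (D ∷ V) W W′ = cong suc (trailingDs-++-U∷ V W W′)

  trailingDs≤length : ∀ V → trailingDs V ≤ length V
  trailingDs≤length []      = z≤n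
  trailingDs≤length (U ∷ V) = z≤n
  trailingDs≤length (D ∷ V) = s≤s (trailingDs≤length V)

  trailingDs-split : ∀ V k → k ≤ trailingDs V → ∃ λ W → V ≡ Dn k ++ W
  trailingDs-split V       zero    _       = V , refl
  trailingDs-split (D ∷ V) (suc k) (s≤s p) = Product.map₂ (cong (D ∷_)) (trailingDs-split V k p)

  L≤length : ∀ P → L P ≤ length P
  L≤length P = subst (L P ≤_) (length-reverse P) (trailingDs≤length (reverse P))

  L-++-Dn : ∀ A k → L (A ++ Dn k) ≡ k + L A
  L-++-Dn A k = begin
    trailingDs (reverse (A ++ Dn k))        ≡⟨ cong trailingDs (reverse-++ A (Dn k)) ⟩
    trailingDs (reverse (Dn k) ++ reverse A) ≡⟨ cong (λ V → trailingDs (V ++ reverse A)) (reverse-Dn k) ⟩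
    trailingDs (Dn k ++ reverse A)           ≡⟨ trailingDs-Dn-++ k (reverse A) ⟩
    k + L A                                  ∎
    where open ≡-Reasoning

  L-++-U∷ : ∀ A B → L (A ++ U ∷ B) ≡ L (U ∷ B)
  L-++-U∷ A B = begin
    trailingDs (reverse (A ++ U ∷ B))               ≡⟨ cong trailingDs (reverse-++ A (U ∷ B)) ⟩
    trailingDs (reverse (U ∷ B) ++ reverse A)       ≡⟨ cong (λ V → trailingDs (V ++ reverse A)) (unfold-reverse U B) ⟩
    trailingDs ((reverse B ∷ʳ U) ++ reverse A)      ≡⟨ cong trailingDs (++-assoc (reverse B) [ U ] (reverse A)) ⟩
    trailingDs (reverse B ++ U ∷ reverse A)         ≡⟨ trailingDs-++-U∷ (reverse B) (reverse A) [] ⟩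
    trailingDs (reverse B ++ U ∷ [])                ≡⟨ cong trailingDs (unfold-reverse U B) ⟨
    L (U ∷ B)                                       ∎
    where open ≡-Reasoning

  L-split : ∀ R k → k ≤ L R → ∃ λ A → R ≡ A ++ Dn k
  L-split R k k≤L with trailingDs-split (reverse R) k k≤L
  ... | W , rev-R = reverse W , (begin
    R                            ≡⟨ reverse-involutive R ⟨
    reverse (reverse R)          ≡⟨ cong reverse rev-R ⟩
    reverse (Dn k ++ W)          ≡⟨ reverse-++ (Dn k) W ⟩
    reverse W ++ reverse (Dn k)  ≡⟨ cong (reverse W ++_) (reverse-Dn k) ⟩
    reverse W ++ Dn k            ∎)
    where open ≡-Reasoning

  -- Products P ×_k Q with k ≤ L P

  ×-Dn : ∀ A k Q → (A ++ Dn k) ×[ k ] Q ≡ A ++ Q ++ Dn k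
  ×-Dn A k Q = cong (_++ (Q ++ Dn k)) (begin
    take (length (A ++ Dn k) ∸ k) (A ++ Dn k)  ≡⟨ cong (λ i → take i (A ++ Dn k)) (length-++-replicate-∸ A k D) ⟩
    take (length A) (A ++ Dn k)                ≡⟨ take-length-++ A (Dn k) ⟩
    A                                          ∎)
    where open ≡-Reasoning

  size-× : ∀ {R k} Q → k ≤ L R → size (R ×[ k ] Q) ≡ size R + size Q
  size-× {R} {k} Q k≤L with L-split R k k≤L
  ... | A , refl = trans (cong size (×-Dn A k Q)) (size-insert A Q (Dn k))

  length-× : ∀ {R k} Q → k ≤ L R → length (R ×[ k ] Q) ≡ length R + length Q
  length-× {R} {k} Q k≤L with L-split R k k≤L
  ... | A , refl = trans (cong length (×-Dn A k Q)) (length-insert A Q (Dn k))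

  L-× : ∀ {R k} Q′ → k ≤ L R → L (R ×[ k ] (U ∷ Q′)) ≡ k + L (U ∷ Q′)
  L-× {R} {k} Q′ k≤L with L-split R k k≤L
  ... | A , refl = begin
    L ((A ++ Dn k) ×[ k ] (U ∷ Q′))  ≡⟨ cong L (×-Dn A k (U ∷ Q′)) ⟩
    L (A ++ (U ∷ Q′) ++ Dn k)        ≡⟨ cong L (++-assoc A (U ∷ Q′) (Dn k)) ⟨
    L ((A ++ U ∷ Q′) ++ Dn k)        ≡⟨ L-++-Dn (A ++ U ∷ Q′) k ⟩
    k + L (A ++ U ∷ Q′)              ≡⟨ cong (k +_) (L-++-U∷ A Q′) ⟩
    k + L (U ∷ Q′)                   ∎
    where open ≡-Reasoning

  prefixLength : Path → ℕ
  prefixLength P = length P ∸ L P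

  -- Multiplicities of colours

  ≡ᵇ-refl : ∀ k → (k ≡ᵇ k) ≡ true
  ≡ᵇ-refl k = Equivalence.to T-≡ (≡⇒≡ᵇ k k refl)

  m∸[m∸n]≤n : ∀ m n → m ∸ (m ∸ n) ≤ n
  m∸[m∸n]≤n m n = m≤n+o⇒m∸n≤o m (m ∸ n) (subst (m ≤_) (+-comm n (m ∸ n)) (m≤n+m∸n m n))

  count-replicate : ∀ x j → count x (replicate j x) ≡ j
  count-replicate x zero                      = refl
  count-replicate x (suc j) rewrite ≡ᵇ-refl x = cong suc (count-replicate x j)

  foldr-⊔-replicate : ∀ (f : ℕ → ℕ) x i → foldr (λ k acc → f k ⊔ acc) 0 (replicate (suc i) x) ≡ f x
  foldr-⊔-replicate f x zero    = ⊔-identityʳ (f x)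
  foldr-⊔-replicate f x (suc i) = trans (cong (f x ⊔_) (foldr-⊔-replicate f x i)) (⊔-idem (f x))

  maxMult-replicate : ∀ x j → maxMult (replicate j x) ≡ j
  maxMult-replicate x zero    = refl
  maxMult-replicate x (suc j) =
    trans (foldr-⊔-replicate (λ k → count k (replicate (suc j) x)) x j) (count-replicate x (suc j))

  count≤length : ∀ k w → count k w ≤ length w
  count≤length k []      = z≤n
  count≤length k (x ∷ w) with k ≡ᵇ x
  ... | true  = s≤s (count≤length k w)
  ... | false = m≤n⇒m≤1+n (count≤length k w)

  maxMult≤length : ∀ w → maxMult w ≤ length w
  maxMult≤length w = bound w
    where
      bound : ∀ v → foldr (λ k acc → count k w ⊔ acc) 0 v ≤ length w
      bound []      = z≤n
      bound (k ∷ v) = ⊔-lub (count≤length k w) (bound v)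

  maxMult-lastColors≤ : ∀ m P k → maxMult (lastColors m P k) ≤ k
  maxMult-lastColors≤ m P k = begin
    maxMult (drop (length cs ∸ k) cs)  ≤⟨ maxMult≤length (drop (length cs ∸ k) cs) ⟩
    length (drop (length cs ∸ k) cs)   ≡⟨ length-drop (length cs ∸ k) cs ⟩
    length cs ∸ (length cs ∸ k)        ≤⟨ m∸[m∸n]≤n (length cs) k ⟩
    k                                  ∎
    where
      open ≤-Reasoning
      cs = downColors m P

  -- OkFrom⁺ m h w: as OkFrom m h w, but w touches the x-axis only at its end.
  data OkFrom⁺ (m : ℕ) : ℕ → Path → Set where
    last : OkFrom⁺ m 1 (D ∷ [])
    down : ∀ {h w} → OkFrom⁺ m (suc h) w → OkFrom⁺ m (suc (suc h)) (D ∷ w)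
    up   : ∀ {h w} → OkFrom⁺ m (suc h + m) w → OkFrom⁺ m (suc h) (U ∷ w)

  module _ {m : ℕ} where

    OkFrom-Dn : ∀ k → OkFrom m k (Dn k)
    OkFrom-Dn zero    = refl
    OkFrom-Dn (suc k) = OkFrom-Dn k

    OkFrom-size0⇒Dn : ∀ {h} w → OkFrom m h w → size w ≡ 0 → w ≡ Dn h
    OkFrom-size0⇒Dn         []      refl _ = refl
    OkFrom-size0⇒Dn {suc h} (D ∷ w) ok   s = cong (D ∷_) (OkFrom-size0⇒Dn w ok s)

    OkFrom-++ : ∀ e X {c Y} → OkFrom m e X → OkFrom m c Y → OkFrom m (e + c) (X ++ Y)
    OkFrom-++ e       []      refl okY = okY
    OkFrom-++ e       (U ∷ X) {c} {Y} okX okY =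
      subst (λ h → OkFrom m h (X ++ Y)) (xy∙z≈xz∙y e m c) (OkFrom-++ (e + m) X okX okY)
    OkFrom-++ (suc e) (D ∷ X) okX okY = OkFrom-++ e X okX okY

    OkFrom-insert : ∀ {h} A {B Q} → OkFrom m h (A ++ B) → IsDyck m Q → OkFrom m h (A ++ Q ++ B)
    OkFrom-insert         []      {B} {Q} ok okQ = OkFrom-++ 0 Q okQ ok
    OkFrom-insert         (U ∷ A) ok okQ = OkFrom-insert A ok okQ
    OkFrom-insert {suc h} (D ∷ A) ok okQ = OkFrom-insert A ok okQ

    ×-dyck : ∀ {R k Q} → k ≤ L R → IsDyck m R → IsDyck m Q → IsDyck m (R ×[ k ] Q)
    ×-dyck {R} {k} {Q} k≤L okR okQ with L-split R k k≤L
    ... | A , refl = subst (IsDyck m) (sym (×-Dn A k Q)) (OkFrom-insert A okR okQ)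

    OkFrom⁺⇒OkFrom : ∀ {h w} → OkFrom⁺ m h w → OkFrom m h w
    OkFrom⁺⇒OkFrom last     = refl
    OkFrom⁺⇒OkFrom (down r) = OkFrom⁺⇒OkFrom r
    OkFrom⁺⇒OkFrom (up r)   = OkFrom⁺⇒OkFrom r

    OkFrom⁺-Dn : ∀ {k} → 1 ≤ k → OkFrom⁺ m k (Dn k)
    OkFrom⁺-Dn {suc zero}    _ = last
    OkFrom⁺-Dn {suc (suc k)} _ = down (OkFrom⁺-Dn (s≤s z≤n))

    OkFrom-++-OkFrom⁺ : ∀ e X {c Y} → OkFrom m e X → OkFrom⁺ m (suc c) Y → OkFrom⁺ m (suc (e + c)) (X ++ Y)
    OkFrom-++-OkFrom⁺ e       []      refl r = r
    OkFrom-++-OkFrom⁺ e       (U ∷ X) {c} {Y} okX r =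
      up (subst (λ h → OkFrom⁺ m (suc h) (X ++ Y)) (xy∙z≈xz∙y e m c) (OkFrom-++-OkFrom⁺ (e + m) X okX r))
    OkFrom-++-OkFrom⁺ (suc e) (D ∷ X) okX r = down (OkFrom-++-OkFrom⁺ e X okX r)

    OkFrom⁺-no-early-return : ∀ {h} A {B} → OkFrom m h A → OkFrom⁺ m h (A ++ B) → B ≡ []
    OkFrom⁺-no-early-return []          refl ()
    OkFrom⁺-no-early-return (U ∷ A)     ok   (up r)   = OkFrom⁺-no-early-return A ok r
    OkFrom⁺-no-early-return (D ∷ [])    ok   last     = refl
    OkFrom⁺-no-early-return (D ∷ [])    ()   (down r)
    OkFrom⁺-no-early-return (D ∷ x ∷ A) ok   (down r) = OkFrom⁺-no-early-return (x ∷ A) ok r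

    OkFrom⁺⇒prime : ∀ {Q′} → OkFrom⁺ m m Q′ → IsPrime m (U ∷ Q′)
    OkFrom⁺⇒prime r = (OkFrom⁺⇒OkFrom r , s≤s z≤n) , λ where
      ([]    , _ , (_ , ()) , _)
      (D ∷ _ , _ , (() , _) , _)
      (U ∷ A , B , (okA , _) , (_ , 1≤size-B) , Q≡A++B) →
        1+n≰n (subst (λ B → 1 ≤ size B)
                      (OkFrom⁺-no-early-return A okA (subst (OkFrom⁺ m m) (∷-injectiveʳ Q≡A++B) r))
                      1≤size-B)

    -- w, started at height h, is X (descending to height j without going below
    -- it), then a prime path U ∷ Q′ lifted to height j, then j down steps.
    record LastFactor (h : ℕ) (w : Path) : Set where
      constructor factor
      field
        X Q′   : Path
        j      : ℕ
        j≤h    : j ≤ h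
        X-ok   : OkFrom m (h ∸ j) X
        Q′-ok  : OkFrom⁺ m m Q′
        splits : w ≡ X ++ (U ∷ Q′) ++ Dn j

    prependD : ∀ {h w} → LastFactor h w → LastFactor (suc h) (D ∷ w)
    prependD (factor X Q′ j j≤h X-ok Q′-ok refl) =
      factor (D ∷ X) Q′ j (m≤n⇒m≤1+n j≤h)
             (subst (λ e → OkFrom m e (D ∷ X)) (sym (+-∸-assoc 1 j≤h)) X-ok) Q′-ok refl

    prependU-keep : ∀ {h w} (r : LastFactor (h + m) w) → LastFactor.j r ≤ h → LastFactor h (U ∷ w)
    prependU-keep (factor X Q′ j _ X-ok Q′-ok refl) j≤h =
      factor (U ∷ X) Q′ j j≤h (subst (λ e → OkFrom m e X) (+-∸-comm m j≤h) X-ok) Q′-ok refl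

    absorbed-height : ∀ h c → suc (h + c) ≤ h + m → suc ((h + m ∸ suc (h + c)) + c) ≡ m
    absorbed-height h c le = +-cancelˡ-≡ h _ _ (begin
      h + suc (e + c)      ≡⟨ +-suc h (e + c) ⟩
      suc (h + (e + c))    ≡⟨ cong suc (x∙yz≈xz∙y h e c) ⟩
      suc (h + c + e)      ≡⟨ cong suc (+-comm (h + c) e) ⟩
      suc (e + (h + c))    ≡⟨ +-suc e (h + c) ⟨
      e + suc (h + c)      ≡⟨ m∸n+n≡m le ⟩
      h + m                ∎)
      where
        open ≡-Reasoning
        e = h + m ∸ suc (h + c)

    -- A factor that dips below the starting height h swallows the new up step.
    prependU-absorb : ∀ {h w} (r : LastFactor (h + m) w) → h < LastFactor.j r → LastFactor h (U ∷ w)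
    prependU-absorb {h} (factor X Q′ j j≤h+m X-ok Q′-ok refl) h<j with m≤n⇒∃[o]m+o≡n h<j
    ... | c , refl = factor [] (X ++ (U ∷ Q′) ++ Dn (suc c)) h ≤-refl (n∸n≡0 h) Q″-ok (cong (U ∷_) split)
      where
        Q″-ok : OkFrom⁺ m m (X ++ (U ∷ Q′) ++ Dn (suc c))
        Q″-ok = subst (λ k → OkFrom⁺ m k (X ++ (U ∷ Q′) ++ Dn (suc c))) (absorbed-height h c j≤h+m)
          (OkFrom-++-OkFrom⁺ _ X X-ok (OkFrom-++-OkFrom⁺ 0 (U ∷ Q′) (OkFrom⁺⇒OkFrom Q′-ok) (OkFrom⁺-Dn (s≤s z≤n))))
        split : X ++ (U ∷ Q′) ++ Dn (suc (h + c)) ≡ (X ++ (U ∷ Q′) ++ Dn (suc c)) ++ Dn h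
        split = begin
          X ++ (U ∷ Q′) ++ Dn (suc (h + c))     ≡⟨ cong (λ k → X ++ (U ∷ Q′) ++ Dn (suc k)) (+-comm h c) ⟩
          X ++ (U ∷ Q′) ++ Dn (suc c + h)       ≡⟨ cong (λ V → X ++ (U ∷ Q′) ++ V) (Dn-++ (suc c) h) ⟨
          X ++ (U ∷ Q′) ++ Dn (suc c) ++ Dn h   ≡⟨ cong (X ++_) (++-assoc (U ∷ Q′) (Dn (suc c)) (Dn h)) ⟨
          X ++ ((U ∷ Q′) ++ Dn (suc c)) ++ Dn h ≡⟨ ++-assoc X _ (Dn h) ⟨
          (X ++ (U ∷ Q′) ++ Dn (suc c)) ++ Dn h ∎
          where open ≡-Reasoning

    prependU : ∀ {h w} → LastFactor (h + m) w → LastFactor h (U ∷ w)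
    prependU {h} r with LastFactor.j r ≤? h
    ... | yes j≤h = prependU-keep r j≤h
    ... | no  j≰h = prependU-absorb r (≰⇒> j≰h)

    lastFactor-U∷Dn : ∀ {h w} → 1 ≤ m → OkFrom m (h + m) w → size w ≡ 0 → LastFactor h (U ∷ w)
    lastFactor-U∷Dn {h} {w} 1≤m ok size0 =
      factor [] (Dn m) h ≤-refl (n∸n≡0 h) (OkFrom⁺-Dn 1≤m) (cong (U ∷_) (begin
        w             ≡⟨ OkFrom-size0⇒Dn w ok size0 ⟩
        Dn (h + m)    ≡⟨ cong Dn (+-comm h m) ⟩
        Dn (m + h)    ≡⟨ Dn-++ m h ⟨
        Dn m ++ Dn h  ∎))
      where open ≡-Reasoning

    lastFactor : 1 ≤ m → ∀ h w → OkFrom m h w → 1 ≤ size w → LastFactor h w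
    lastFactor 1≤m (suc h) (D ∷ w) ok sz = prependD (lastFactor 1≤m h w ok sz)
    lastFactor 1≤m h       (U ∷ w) ok _ with size w in size-w
    ... | zero  = lastFactor-U∷Dn 1≤m ok size-w
    ... | suc _ = prependU (lastFactor 1≤m (h + m) w ok (subst (1 ≤_) (sym size-w) (s≤s z≤n)))

    -- In colorsFrom, ups holds (start height, rank) of the up steps read so far,
    -- newest first; its last entry is the first up step (0 , 1).

    findColor-skip : ∀ {j h} ups rest → All (λ u → j ≤ proj₁ u) ups → h ≤ j →
                     findColor m h (ups ++ rest) ≡ findColor m h rest
    findColor-skip                []              rest []          _   = refl
    findColor-skip {h = h} ((a , r) ∷ ups) rest (j≤a ∷ j≤s) h≤j with a <ᵇ h | <ᵇ⇒< a h
    ... | false | _   = findColor-skip ups rest j≤s h≤j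
    ... | true  | a<h = ⊥-elim (<⇒≱ (a<h tt) (≤-trans h≤j j≤a))

    findColor-first : ∀ {h} → 1 ≤ h → h ≤ m → findColor m h ((0 , 1) ∷ []) ≡ 1
    findColor-first {suc h} _ h≤m with suc h ≤ᵇ m | ≤⇒≤ᵇ h≤m
    ... | true | _ = refl

    colorsFrom-Dn : ∀ {j} h k ups → All (λ u → j ≤ proj₁ u) ups → h ≤ j → j ≤ m →
                    colorsFrom m h k (ups ++ (0 , 1) ∷ []) (Dn h) ≡ replicate h 1
    colorsFrom-Dn zero    k ups j≤s _   _   = refl
    colorsFrom-Dn (suc h) k ups j≤s h≤j j≤m =
      cong₂ _∷_ (trans (findColor-skip ups _ j≤s h≤j) (findColor-first (s≤s z≤n) (≤-trans h≤j j≤m)))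
                (colorsFrom-Dn h k ups j≤s (≤-trans (n≤1+n h) h≤j) j≤m)

    colorsFrom-++-Dn : ∀ {j} e X k ups → OkFrom m e X → All (λ u → j ≤ proj₁ u) ups → j ≤ m →
      ∃ λ cs → colorsFrom m (e + j) k (ups ++ (0 , 1) ∷ []) (X ++ Dn j) ≡ cs ++ replicate j 1
    colorsFrom-++-Dn {j} e []      k ups refl j≤s j≤m = [] , colorsFrom-Dn j k ups j≤s ≤-refl j≤m
    colorsFrom-++-Dn {j} e (U ∷ X) k ups okX  j≤s j≤m =
      Product.map₂ (trans (cong (λ h → colorsFrom m h (suc k) ((e + j , suc k) ∷ ups ++ (0 , 1) ∷ []) (X ++ Dn j))
                                (xy∙z≈xz∙y e j m)))
        (colorsFrom-++-Dn (e + m) X (suc k) ((e + j , suc k) ∷ ups) okX (m≤n+m j e ∷ j≤s) j≤m)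
    colorsFrom-++-Dn (suc e) (D ∷ X) k ups okX j≤s j≤m =
      Product.map (_ ∷_) (cong (_ ∷_)) (colorsFrom-++-Dn e X k ups okX j≤s j≤m)

    lastColors-lift : ∀ {j X} → j ≤ m → OkFrom m (m ∸ j) X → lastColors m (U ∷ X ++ Dn j) j ≡ replicate j 1
    lastColors-lift {j} {X} j≤m okX with colorsFrom-++-Dn (m ∸ j) X 1 [] okX [] j≤m
    ... | cs , colours = begin
      drop (length cs′ ∸ j) cs′          ≡⟨ cong (λ ds → drop (length ds ∸ j) ds) cs′≡ ⟩
      drop (length ones ∸ j) ones        ≡⟨ cong (λ i → drop i ones) (length-++-replicate-∸ cs j 1) ⟩
      drop (length cs) ones              ≡⟨ drop-length-++ cs (replicate j 1) ⟩
      replicate j 1                      ∎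
      where
        open ≡-Reasoning
        cs′  = downColors m (U ∷ X ++ Dn j)
        ones = cs ++ replicate j 1
        cs′≡ : cs′ ≡ ones
        cs′≡ = trans (cong (λ h → colorsFrom m h 1 ((0 , 1) ∷ []) (X ++ Dn j)) (sym (m∸n+n≡m j≤m))) colours

    record Factorisation (P : Path) : Set where
      field
        R Q′         : Path
        j            : ℕ
        j≤m          : j ≤ m
        j≤L          : j ≤ L R
        R-ok         : IsDyck⁺ m R
        Q′-ok        : OkFrom⁺ m m Q′
        last-colours : lastColors m R j ≡ replicate j 1
        P≡R×Q        : P ≡ R ×[ j ] (U ∷ Q′)

    factorise : 1 ≤ m → ∀ {P} → IsDyck m P → 2 ≤ size P → Factorisation P
    factorise 1≤m {U ∷ w} ok (s≤s sz) with lastFactor 1≤m m w ok sz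
    ... | factor X Q′ j j≤m X-ok Q′-ok refl = record
      { R            = U ∷ X ++ Dn j
      ; Q′           = Q′
      ; j            = j
      ; j≤m          = j≤m
      ; j≤L          = subst (j ≤_) (sym (L-++-Dn (U ∷ X) j)) (m≤m+n j _)
      ; R-ok         = subst (λ h → OkFrom m h (X ++ Dn j)) (m∸n+n≡m j≤m) (OkFrom-++ (m ∸ j) X X-ok (OkFrom-Dn j))
                       , s≤s z≤n
      ; Q′-ok        = Q′-ok
      ; last-colours = lastColors-lift {X = X} j≤m X-ok
      ; P≡R×Q        = sym (×-Dn (U ∷ X) j (U ∷ Q′))
      }

    module _ {P} (F : Factorisation P) where
      open Factorisation F

      size-factors : size R + size (U ∷ Q′) ≡ size P
      size-factors = trans (sym (size-× (U ∷ Q′) j≤L)) (cong size (sym P≡R×Q))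

      sibling-dyck : ∀ {k} → k ≤ L R → IsDyck m (R ×[ k ] (U ∷ Q′))
      sibling-dyck k≤L = ×-dyck k≤L (proj₁ R-ok) (OkFrom⁺⇒OkFrom Q′-ok)

      sibling-size : ∀ {k} → k ≤ L R → size (R ×[ k ] (U ∷ Q′)) ≡ size P
      sibling-size k≤L = trans (size-× (U ∷ Q′) k≤L) size-factors

      sibling-shorter : ∀ {k} → k ≤ L R → j < k → prefixLength (R ×[ k ] (U ∷ Q′)) < prefixLength P
      sibling-shorter {k} k≤L j<k = begin-strict
        length Pk ∸ L Pk  <⟨ ∸-monoʳ-< L-grows (L≤length Pk) ⟩
        length Pk ∸ L P   ≡⟨ cong (_∸ L P) same-length ⟩
        length P ∸ L P    ∎
        where
          open ≤-Reasoning
          Pk = R ×[ k ] (U ∷ Q′)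
          same-length : length Pk ≡ length P
          same-length = begin-equality
            length Pk                          ≡⟨ length-× (U ∷ Q′) k≤L ⟩
            length R + length (U ∷ Q′)         ≡⟨ length-× (U ∷ Q′) j≤L ⟨
            length (R ×[ j ] (U ∷ Q′))         ≡⟨ cong length P≡R×Q ⟨
            length P                           ∎
          L-grows : L P < L Pk
          L-grows = begin-strict
            L P                        ≡⟨ cong L P≡R×Q ⟩
            L (R ×[ j ] (U ∷ Q′))      ≡⟨ L-× Q′ j≤L ⟩
            j + L (U ∷ Q′)             <⟨ +-monoˡ-< (L (U ∷ Q′)) j<k ⟩
            k + L (U ∷ Q′)             ≡⟨ L-× Q′ k≤L ⟨
            L Pk                       ∎

  -- Weak compositions into two parts

  comps-one : ∀ u → comps 1 u ≡ [ [ u ] ]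
  comps-one u = begin
    concatMap f (upTo (suc u))         ≡⟨ cong (concatMap f) (upTo-∷ʳ u) ⟨
    concatMap f (upTo u ∷ʳ u)          ≡⟨ concatMap-++ f (upTo u) [ u ] ⟩
    concatMap f (upTo u) ++ f u ++ []  ≡⟨ cong (_++ f u ++ []) (vanish (upTo u) (all-upTo u)) ⟩
    f u ++ []                          ≡⟨ cong (λ i → map (u ∷_) (comps 0 i) ++ []) (n∸n≡0 u) ⟩
    [ [ u ] ]                          ∎
    where
      open ≡-Reasoning
      f : ℕ → List (List ℕ)
      f b = map (b ∷_) (comps 0 (u ∸ b))
      vanish : ∀ bs → All (_< u) bs → concatMap f bs ≡ []
      vanish []       []          = refl
      vanish (b ∷ bs) (b<u ∷ b<s) with u ∸ b in u∸b
      ... | zero  = ⊥-elim (<⇒≢ (m<n⇒0<n∸m b<u) (sym u∸b))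
      ... | suc _ = vanish bs b<s

  comps-two : ∀ t → comps 2 t ≡ map (λ a → a ∷ [ t ∸ a ]) (upTo (suc t))
  comps-two t = begin
    concat (map (λ a → map (a ∷_) (comps 1 (t ∸ a))) as)
      ≡⟨ cong concat (map-cong (λ a → cong (map (a ∷_)) (comps-one (t ∸ a))) as) ⟩
    concat (map ([_] ∘ g) as)       ≡⟨ cong concat (map-∘ {g = [_]} as) ⟩
    concat (map [_] (map g as))     ≡⟨ concat-map-[ map g as ] ⟩
    map g as                        ∎
    where
      open ≡-Reasoning
      as = upTo (suc t)
      g : ℕ → List ℕ
      g a = a ∷ [ t ∸ a ]

  map-∸-upTo : ∀ t → map (t ∸_) (upTo (suc t)) ≡ downFrom (suc t)
  map-∸-upTo zero    = refl
  map-∸-upTo (suc t) = cong (suc t ∷_) (begin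
    map (suc t ∸_) (applyUpTo suc (suc t))  ≡⟨ map-applyUpTo suc (suc t ∸_) (suc t) ⟩
    applyUpTo (t ∸_) (suc t)                ≡⟨ map-upTo (t ∸_) (suc t) ⟨
    map (t ∸_) (upTo (suc t))               ≡⟨ map-∸-upTo t ⟩
    downFrom (suc t)                         ∎)
    where open ≡-Reasoning

module Coefficients {c ℓ} (K : Field c ℓ) where
  open Paths
  open import Data.Nat.Properties as ℕ using (≡ᵇ⇒≡; ≡⇒≡ᵇ; <⇒≢; <⇒≤; ≤-pred; ≤-refl; m≤n⇒m<n∨m≡n)
  open Field K renaming (refl to ≈-refl; sym to ≈-sym; trans to ≈-trans)
  open FreeVec K
  open import Relation.Binary.Reasoning.Setoid setoid
  open import Algebra.Properties.Ring ring using (-‿distribˡ-*)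
  open import Algebra.Properties.AbelianGroup +-abelianGroup using (⁻¹-∙-comm; ε⁻¹≈ε)
  open import Algebra.Properties.CommutativeSemigroup +-commutativeSemigroup using (x∙yz≈y∙xz)

  sumBelow : ℕ → (ℕ → Carrier) → Carrier
  sumBelow t f = sumK (map f (downFrom t))

  omit : ℕ → (ℕ → Carrier) → ℕ → Carrier
  omit j f k = if k ≡ᵇ j then 0# else f k

  omit-self : ∀ j f → omit j f j ≡ 0#
  omit-self j f rewrite ≡ᵇ-refl j = refl

  omit-≢ : ∀ {j k} f → k ≢ j → omit j f k ≡ f k
  omit-≢ {j} {k} f k≢j with k ≡ᵇ j | ≡ᵇ⇒≡ k j
  ... | true  | k≡j = ⊥-elim (k≢j (k≡j tt))
  ... | false | _   = refl

  sumBelow-omit-absent : ∀ {j} t f → t ≤ j → sumBelow t (omit j f) ≈ sumBelow t f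
  sumBelow-omit-absent zero    f _   = ≈-refl
  sumBelow-omit-absent (suc t) f t<j =
    +-cong (reflexive (omit-≢ f (<⇒≢ t<j))) (sumBelow-omit-absent t f (<⇒≤ t<j))

  sumBelow-omit : ∀ {j} t f → j < t → sumBelow t f ≈ f j + sumBelow t (omit j f)
  sumBelow-omit {j} (suc t) f j<t with m≤n⇒m<n∨m≡n (≤-pred j<t)
  ... | inj₂ refl = +-cong ≈-refl (begin
    sumBelow t f                   ≈⟨ sumBelow-omit-absent t f ≤-refl ⟨
    sumBelow t (omit t f)          ≈⟨ +-identityˡ _ ⟨
    0# + sumBelow t (omit t f)     ≡⟨ cong (_+ sumBelow t (omit t f)) (omit-self t f) ⟨
    omit t f t + sumBelow t (omit t f) ∎)
  ... | inj₁ j<t′ = begin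
    f t + sumBelow t f                           ≈⟨ +-cong ≈-refl (sumBelow-omit t f j<t′) ⟩
    f t + (f j + sumBelow t (omit j f))          ≈⟨ x∙yz≈y∙xz _ _ _ ⟩
    f j + (f t + sumBelow t (omit j f))
      ≡⟨ cong (λ x → f j + (x + sumBelow t (omit j f))) (omit-≢ f (<⇒≢ j<t′ ∘ sym)) ⟨
    f j + (omit j f t + sumBelow t (omit j f))   ∎

  summandCoeff : ℕ → ℕ → Path → Path → ℕ → Path → Carrier
  summandCoeff m i R Q k S = bool→K ((maxMult (lastColors m R k) ≡ᵇ i) ∧ pathEqᵇ (R ×[ k ] Q) S)

  starCoeff-prime : ∀ m i R Q S →
                    starCoeff m i R (Q ∷ []) S ≈ sumBelow (suc (L R)) (λ k → summandCoeff m i R Q k S)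
  starCoeff-prime m i R Q S = begin
    sumK (map φ (comps 2 t))                       ≡⟨ cong (sumK ∘ map φ) (comps-two t) ⟩
    sumK (map φ (map (λ a → a ∷ [ t ∸ a ]) as))    ≡⟨ cong sumK (map-∘ {g = φ} as) ⟨
    sumK (map (λ a → φ (a ∷ [ t ∸ a ])) as)
      ≡⟨ cong sumK (map-cong (λ a → cong (summand′ (t ∸ a)) (ℕ.+-identityʳ (t ∸ a))) as) ⟩
    sumK (map (summand ∘ (t ∸_)) as)               ≡⟨ cong sumK (map-∘ {g = summand} as) ⟩
    sumK (map summand (map (t ∸_) as))             ≡⟨ cong (sumK ∘ map summand) (map-∸-upTo t) ⟩
    sumBelow (suc t) summand                       ∎
    where
      t  = L R
      as = upTo (suc t)
      φ : List ℕ → Carrier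
      φ λs = bool→K (inΛᵇ m i R λs ∧ pathEqᵇ (starλ R λs (Q ∷ [])) S)
      summand′ : ℕ → ℕ → Carrier
      summand′ k k′ = bool→K ((maxMult (lastColors m R k) ≡ᵇ i) ∧ pathEqᵇ (R ×[ k′ ] Q) S)
      summand : ℕ → Carrier
      summand k = summandCoeff m i R Q k S

  module _ (m n : ℕ) where

    termsCoeff : List (Term m n) → Path → Carrier
    termsCoeff ts S = sumK (map (λ t → termCoeff t S) ts)

    termsCoeff-++ : ∀ ts us S → termsCoeff (ts ++ us) S ≈ termsCoeff ts S + termsCoeff us S
    termsCoeff-++ []       us S = ≈-sym (+-identityˡ _)
    termsCoeff-++ (t ∷ ts) us S = ≈-trans (+-cong ≈-refl (termsCoeff-++ ts us S)) (≈-sym (+-assoc _ _ _))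

    InSpan : (Path → Carrier) → Set (c Level.⊔ ℓ)
    InSpan v = Σ (List (Term m n)) λ ts → ∀ S → v S ≈ termsCoeff ts S

    InSpan-resp : ∀ {v w} → (∀ S → v S ≈ w S) → InSpan v → InSpan w
    InSpan-resp v≈w (ts , v≈ts) = ts , λ S → ≈-trans (≈-sym (v≈w S)) (v≈ts S)

    InSpan-0 : InSpan (λ _ → 0#)
    InSpan-0 = [] , λ _ → ≈-refl

    InSpan-term : ∀ t → InSpan (termCoeff t)
    InSpan-term t = [ t ] , λ _ → ≈-sym (+-identityʳ _)

    InSpan-+ : ∀ {v w} → InSpan v → InSpan w → InSpan (λ S → v S + w S)
    InSpan-+ (ts , v≈ts) (us , w≈us) =
      ts ++ us , λ S → ≈-trans (+-cong (v≈ts S) (w≈us S)) (≈-sym (termsCoeff-++ ts us S))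

    negateTerm : Term m n → Term m n
    negateTerm t = record t { coef = - Term.coef t }

    termsCoeff-negate : ∀ ts S → termsCoeff (map negateTerm ts) S ≈ - termsCoeff ts S
    termsCoeff-negate []       S = ≈-sym ε⁻¹≈ε
    termsCoeff-negate (t ∷ ts) S =
      ≈-trans (+-cong (≈-sym (-‿distribˡ-* _ _)) (termsCoeff-negate ts S)) (⁻¹-∙-comm _ _)

    InSpan-- : ∀ {v} → InSpan v → InSpan (λ S → - v S)
    InSpan-- (ts , v≈ts) = map negateTerm ts , λ S → ≈-trans (-‿cong (v≈ts S)) (≈-sym (termsCoeff-negate ts S))

    InSpan-sumBelow : ∀ t (f : ℕ → Path → Carrier) → (∀ k → k < t → InSpan (f k)) →
                      InSpan (λ S → sumBelow t (λ k → f k S))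
    InSpan-sumBelow zero    f _    = InSpan-0
    InSpan-sumBelow (suc t) f f-ok =
      InSpan-+ (f-ok t ≤-refl) (InSpan-sumBelow t f (λ k k<t → f-ok k (ℕ.m<n⇒m<1+n k<t)))

    Spanned : Path → Set (c Level.⊔ ℓ)
    Spanned P = IsDyck m P → size P ≡ n → InSpan (basisCoeff P)

    module _ {P} (F : Factorisation {m} P) where
      open Factorisation F

      Q : Path
      Q = U ∷ Q′

      summand-j : ∀ S → summandCoeff m j R Q j S ≡ basisCoeff P S
      summand-j S rewrite last-colours | maxMult-replicate 1 j | ≡ᵇ-refl j | sym P≡R×Q = refl

      siblings : Path → Carrier
      siblings S = sumBelow (suc (L R)) (omit j (λ k → summandCoeff m j R Q k S))

      star-expansion : ∀ S → starCoeff m j R (Q ∷ []) S ≈ basisCoeff P S + siblings S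
      star-expansion S = begin
        starCoeff m j R (Q ∷ []) S                       ≈⟨ starCoeff-prime m j R Q S ⟩
        sumBelow (suc (L R)) (λ k → summandCoeff m j R Q k S) ≈⟨ sumBelow-omit (suc (L R)) _ (s≤s j≤L) ⟩
        summandCoeff m j R Q j S + siblings S            ≡⟨ cong (_+ siblings S) (summand-j S) ⟩
        basisCoeff P S + siblings S                      ∎

      starTerm : size P ≡ n → Term m n
      starTerm size≡n = record
        { coef  = 1#
        ; i     = j
        ; i≤m   = j≤m
        ; R₁    = R
        ; R₂    = Q
        ; R₁-ok = R-ok
        ; R₂-ok = OkFrom⁺⇒OkFrom Q′-ok , s≤s z≤n
        ; R₁<n  = subst (size R <_) (trans (size-factors F) size≡n) (ℕ.m<m+n (size R) (s≤s z≤n))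
        ; R₂<n  = subst (size Q <_) (trans (size-factors F) size≡n) (ℕ.m<n+m (size Q) (proj₂ R-ok))
        ; Qs    = Q ∷ []
        ; Qs-ok = s≤s z≤n , OkFrom⁺⇒prime Q′-ok ∷ [] , ++-identityʳ Q
        }

      basis≈star-siblings : ∀ size≡n S → termCoeff (starTerm size≡n) S + - siblings S ≈ basisCoeff P S
      basis≈star-siblings size≡n S = begin
        1# * starCoeff m j R (Q ∷ []) S + - siblings S   ≈⟨ +-cong (≈-trans (*-identityˡ _) (star-expansion S)) ≈-refl ⟩
        (basisCoeff P S + siblings S) + - siblings S     ≈⟨ +-assoc _ _ _ ⟩
        basisCoeff P S + (siblings S + - siblings S)     ≈⟨ +-cong ≈-refl (-‿inverseʳ _) ⟩
        basisCoeff P S + 0#                              ≈⟨ +-identityʳ _ ⟩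
        basisCoeff P S                                   ∎

      siblings-inSpan : WfRec (_<_ on prefixLength) Spanned P → size P ≡ n → InSpan siblings
      siblings-inSpan ih size≡n = InSpan-sumBelow (suc (L R)) _ sibling
        where
          sibling : ∀ k → k < suc (L R) → InSpan (λ S → omit j (λ k → summandCoeff m j R Q k S) k)
          sibling k k<1+L with k ≡ᵇ j | ≡⇒≡ᵇ k j
          ... | true  | _   = InSpan-0
          ... | false | k≢j with maxMult (lastColors m R k) ≡ᵇ j | ≡ᵇ⇒≡ (maxMult (lastColors m R k)) j
          ...   | false | _    = InSpan-0
          ...   | true  | mm≡j =
            ih {R ×[ k ] Q} (sibling-shorter F k≤L j<k) (sibling-dyck F k≤L) (trans (sibling-size F k≤L) size≡n)
            where
              k≤L = ≤-pred k<1+L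
              j<k = ℕ.≤∧≢⇒< (subst (_≤ k) (mm≡j tt) (maxMult-lastColors≤ m R k)) (λ j≡k → k≢j (sym j≡k))

      factorisation-inSpan : WfRec (_<_ on prefixLength) Spanned P →
                             size P ≡ n → InSpan (basisCoeff P)
      factorisation-inSpan ih size≡n = InSpan-resp (basis≈star-siblings size≡n)
        (InSpan-+ (InSpan-term (starTerm size≡n)) (InSpan-- (siblings-inSpan (λ {P′} → ih {P′}) size≡n)))

proposition5p10 : ∀ {c ℓ : Level} (K : Field c ℓ) (m n : ℕ) → 1 ≤ m → 2 ≤ n →
    (P : Path) → IsDyck m P → size P ≡ n → FreeVec.IsLinCombOfStars K m n P
proposition5p10 {c} {ℓ} K m n 1≤m 2≤n =
  All.wfRec (On.wellFounded prefixLength <-wellFounded) (c Level.⊔ ℓ) (Spanned m n) step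
  where
    open Paths
    open Coefficients K
    step : ∀ P → WfRec (_<_ on prefixLength) (Spanned m n) P → Spanned m n P
    step P ih ok size≡n =
      factorisation-inSpan m n (factorise 1≤m {P} ok (subst (2 ≤_) (sym size≡n) 2≤n)) (λ {P′} → ih {P′}) size≡n
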